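{- Let $G^g$ be a game with activeness, $\bm{\gamma}\in\{0,1\}^{\infty}$ and $n\in\mathbb{Z}_{\ge0}$. If $G^g={\ast}^{\bm{\gamma}}n$, then $\mathcal{G}(G^g)=n$.
   Context: Let $\mathcal{B}=\{0,1\}$. Define $\mathbb{I}_0=\{\emptyset\}\times\mathcal{B}$ and $\mathbb{I}_n=2^{\mathbb{I}_{n-1}}\times\mathcal{B}$ for $n\ge1$; a game with activeness is an element of $\mathbb{I}=\bigcup_{n\ge0}\mathbb{I}_n$. A pair $(G,g)$ is written $G^g$; elements of $G$ are its options, $g=1$ meaning active. The outcome $o$ is defined recursively: $o(G^g)=\mathscr{N}$ if $g=1$ and some option has outcome $\mathscr{P}$, and $o(G^g)=\mathscr{P}$ otherwise. The sum is $G^g+H^h=(\{G'^{g'}+H^h:G'^{g'}\in G^g\}\cup\{G^g+H'^{h'}:H'^{h'}\in H^h\})^{\max\{g,h\}}$. $G^g=H^h$ means $o(G^g+X^x)=o(H^h+X^x)$ for all games $X^x$. For $\bm{\gamma}\in\mathcal{B}^\infty$, ${\ast}^{\bm{\gamma}}i=\{{\ast}^{\bm{\gamma}}j:0\le j<i\}^{\gamma_i}$ recursively. $\mathcal{G}(G^g)=\mathrm{mex}\{\mathcal{G}(G'^{g'}):G'^{g'}\in G^g\}$ recursively, with $\mathrm{mex}\,S=\min(\mathbb{Z}_{\ge0}\setminus S)$. -}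

module Defs where

open import Data.Bool using (Bool; true; false; _∨_; _∧_; if_then_else_)
open import Data.Nat using (ℕ; zero; suc; _≡ᵇ_)
open import Data.List using (List; []; _∷_; _++_; length)
open import Relation.Binary.PropositionalEquality using (_≡_)

-- A game with activeness G^g: a finite collection of options (games) and
-- an activeness bit g (true = 1 = active).  Options are stored as a list;
-- order and repetitions are irrelevant for every notion used below.
data Game : Set where
  mk : List Game → Bool → Game

data Outcome : Set where
  𝒩 𝒫 : Outcome

isP : Outcome → Bool
isP 𝒩 = false
isP 𝒫 = true

mutual
  outcome : Game → Outcome
  outcome (mk Gs g) = if g ∧ anyP Gs then 𝒩 else 𝒫

  anyP : List Game → Bool
  anyP [] = false
  anyP (G ∷ Gs) = isP (outcome G) ∨ anyP Gs

mutual
  _⊕_ : Game → Game → Game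
  mk Gs g ⊕ mk Hs h = mk (leftOpts Gs (mk Hs h) ++ rightOpts Gs g Hs) (g ∨ h)

  leftOpts : List Game → Game → List Game
  leftOpts [] H = []
  leftOpts (G' ∷ Gs) H = (G' ⊕ H) ∷ leftOpts Gs H

  rightOpts : List Game → Bool → List Game → List Game
  rightOpts Gs g [] = []
  rightOpts Gs g (H' ∷ Hs) = (mk Gs g ⊕ H') ∷ rightOpts Gs g Hs

_≈_ : Game → Game → Set
G ≈ H = ∀ (X : Game) → outcome (G ⊕ X) ≡ outcome (H ⊕ X)

-- ∗^γ i = { ∗^γ j : 0 ≤ j < i }^{γ_i}, for γ ∈ {0,1}^∞ given as ℕ → Bool
mutual
  star : (ℕ → Bool) → ℕ → Game
  star γ i = mk (starsBelow γ i) (γ i)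

  starsBelow : (ℕ → Bool) → ℕ → List Game
  starsBelow γ zero = []
  starsBelow γ (suc i) = starsBelow γ i ++ (star γ i ∷ [])

elemℕ : ℕ → List ℕ → Bool
elemℕ n [] = false
elemℕ n (m ∷ ms) = (n ≡ᵇ m) ∨ elemℕ n ms

-- mex S = least natural not in S (search from 0; length S + 1 steps suffice)
mexSearch : List ℕ → ℕ → ℕ → ℕ
mexSearch S zero n = n
mexSearch S (suc k) n = if elemℕ n S then mexSearch S k (suc n) else n

mex : List ℕ → ℕ
mex S = mexSearch S (suc (length S)) 0

mutual
  grundy : Game → ℕ
  grundy (mk Gs g) = mex (grundyList Gs)

  grundyList : List Game → List ℕ
  grundyList [] = []
  grundyList (G ∷ Gs) = grundy G ∷ grundyList Gs

module Submission where

-- The all-active nim heap ∗m = ∗^(1,1,…) m makes every position of G + ∗m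
-- active.  Hence equal games have
-- equal Grundy values, and 𝒢(∗^γ n) = n because the options of ∗^γ n have
-- Grundy values 0, …, n − 1.

open import Defs
open import Data.Bool using (Bool; true; false; not; _∨_)
open import Data.Bool.Properties using (∨-assoc; ∨-identityʳ; ∨-zeroʳ; ¬-not; T-≡)
open import Data.Fin using (Fin; toℕ)
open import Data.Fin.Properties using (pigeonhole; toℕ<n)
open import Data.List using ([]; _∷_; _++_; length)
open import Data.List.Membership.Propositional using (_∈_)
open import Data.List.Membership.Setoid.Properties using (index-injective)
open import Data.List.Relation.Unary.Any using (here; there; index)
open import Data.Nat using (ℕ; zero; suc; _+_; _≤_; _<_; z≤n; _≡ᵇ_; _<ᵇ_)
open import Data.Nat.Properties
  using (≡ᵇ⇒≡; ≡⇒≡ᵇ; <ᵇ⇒<; <⇒<ᵇ; <-cmp; ≤-refl; ≤⇒≯; <⇒≢; >⇒≢; n≮n;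
         m≤n⇒m<n∨m≡n; +-identityʳ; +-suc; ≮⇒≥)
open import Data.Product using (_,_)
open import Data.Sum using (_⊎_; inj₁; inj₂)
open import Function using (_∘_; Equivalence)
open import Relation.Binary using (tri<; tri≈; tri>)
open import Relation.Binary.PropositionalEquality
  using (_≡_; _≢_; refl; sym; trans; cong; cong₂; subst; setoid; module ≡-Reasoning)
open import Relation.Nullary using (¬_; contradiction)

open Equivalence using (to; from)
open ≡-Reasoning

≡ᵇ-true⇒≡ : ∀ {m n} → (m ≡ᵇ n) ≡ true → m ≡ n
≡ᵇ-true⇒≡ {m} {n} eq = ≡ᵇ⇒≡ m n (from T-≡ eq)

≡ᵇ-refl : ∀ n → (n ≡ᵇ n) ≡ true
≡ᵇ-refl n = to T-≡ (≡⇒≡ᵇ n n refl)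

≡ᵇ-sym : ∀ m n → (m ≡ᵇ n) ≡ (n ≡ᵇ m)
≡ᵇ-sym zero    zero    = refl
≡ᵇ-sym zero    (suc n) = refl
≡ᵇ-sym (suc m) zero    = refl
≡ᵇ-sym (suc m) (suc n) = ≡ᵇ-sym m n

≢⇒≡ᵇ-false : ∀ {m n} → m ≢ n → (m ≡ᵇ n) ≡ false
≢⇒≡ᵇ-false m≢n = ¬-not (m≢n ∘ ≡ᵇ-true⇒≡)

<⇒<ᵇ-true : ∀ {m n} → m < n → (m <ᵇ n) ≡ true
<⇒<ᵇ-true m<n = to T-≡ (<⇒<ᵇ m<n)

≥⇒<ᵇ-false : ∀ {m n} → n ≤ m → (m <ᵇ n) ≡ false
≥⇒<ᵇ-false {m} {n} n≤m = ¬-not (λ m<ᵇn → ≤⇒≯ n≤m (<ᵇ⇒< m n (from T-≡ m<ᵇn)))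

<ᵇ-suc : ∀ m n → (m <ᵇ suc n) ≡ ((m <ᵇ n) ∨ (m ≡ᵇ n))
<ᵇ-suc zero    zero    = refl
<ᵇ-suc zero    (suc n) = refl
<ᵇ-suc (suc m) zero    = refl
<ᵇ-suc (suc m) (suc n) = <ᵇ-suc m n

elemℕ-++ : ∀ k xs ys → elemℕ k (xs ++ ys) ≡ (elemℕ k xs ∨ elemℕ k ys)
elemℕ-++ k []       ys = refl
elemℕ-++ k (x ∷ xs) ys =
  trans (cong ((k ≡ᵇ x) ∨_) (elemℕ-++ k xs ys)) (sym (∨-assoc (k ≡ᵇ x) _ _))

elemℕ⇒∈ : ∀ {k} S → elemℕ k S ≡ true → k ∈ S
elemℕ⇒∈ {k} (m ∷ S) k∈S with k ≡ᵇ m in k≡ᵇm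
... | true  = here (≡ᵇ-true⇒≡ k≡ᵇm)
... | false = there (elemℕ⇒∈ S k∈S)

∈-initialSegment⇒≤length : ∀ {n} S → (∀ k → k < n → k ∈ S) → n ≤ length S
∈-initialSegment⇒≤length {n} S covers = ≮⇒≥ too-short
  where
  position : (i : Fin n) → toℕ i ∈ S
  position i = covers (toℕ i) (toℕ<n i)

  too-short : ¬ length S < n
  too-short ∣S∣<n with pigeonhole ∣S∣<n (index ∘ position)
  ... | i , j , i<j , same-index =
    <⇒≢ i<j (index-injective (setoid ℕ) (position i) (position j) same-index)

mexSearch-covers : ∀ S f {n k} → n ≤ k → k < mexSearch S f n → elemℕ k S ≡ true
mexSearch-covers S zero    n≤k k<n = contradiction k<n (≤⇒≯ n≤k)
mexSearch-covers S (suc f) {n} n≤k k<r with elemℕ n S in n∈S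
... | false = contradiction k<r (≤⇒≯ n≤k)
... | true with m≤n⇒m<n∨m≡n n≤k
...   | inj₁ n<k  = mexSearch-covers S f n<k k<r
...   | inj₂ refl = n∈S

mexSearch-∉-or-exhausted : ∀ S f n →
  elemℕ (mexSearch S f n) S ≡ false ⊎ mexSearch S f n ≡ f + n
mexSearch-∉-or-exhausted S zero    n = inj₂ refl
mexSearch-∉-or-exhausted S (suc f) n with elemℕ n S in n∈S
... | false = inj₁ n∈S
... | true with mexSearch-∉-or-exhausted S f (suc n)
...   | inj₁ ∉S        = inj₁ ∉S
...   | inj₂ exhausted = inj₂ (trans exhausted (+-suc f n))

mex-minimal : ∀ S {k} → k < mex S → elemℕ k S ≡ true
mex-minimal S = mexSearch-covers S (suc (length S)) z≤n

-- The search budget length S + 1 never runs out: by pigeonhole S cannot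
-- contain all of 0, …, length S.
mex-∉ : ∀ S → elemℕ (mex S) S ≡ false
mex-∉ S with mexSearch-∉-or-exhausted S (suc (length S)) 0
... | inj₁ ∉S        = ∉S
... | inj₂ exhausted = contradiction
  (∈-initialSegment⇒≤length S λ k k<1+∣S∣ →
    elemℕ⇒∈ S (mex-minimal S (subst (k <_) (sym (trans exhausted (+-identityʳ _))) k<1+∣S∣)))
  (n≮n (length S))

mex-≡ᵇ : ∀ S m → (mex S ≡ᵇ m) ≡ not (elemℕ m S ∨ (mex S <ᵇ m))
mex-≡ᵇ S m with <-cmp m (mex S)
... | tri< m<mex _ _ rewrite mex-minimal S m<mex | ≢⇒≡ᵇ-false (>⇒≢ m<mex) = refl
... | tri≈ _ refl _ rewrite mex-∉ S | ≡ᵇ-refl m | ≥⇒<ᵇ-false (≤-refl {m}) = refl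
... | tri> _ _ mex<m
  rewrite ≢⇒≡ᵇ-false (<⇒≢ mex<m) | <⇒<ᵇ-true mex<m | ∨-zeroʳ (elemℕ m S) = refl

mex-initialSegment : ∀ S {n} → (∀ k → elemℕ k S ≡ (k <ᵇ n)) → mex S ≡ n
mex-initialSegment S {n} S-is-below-n = ≡ᵇ-true⇒≡ (begin
  mex S ≡ᵇ n
    ≡⟨ mex-≡ᵇ S n ⟩
  not (elemℕ n S ∨ (mex S <ᵇ n))
    ≡⟨ cong₂ (λ a b → not (a ∨ b)) (S-is-below-n n) (sym (S-is-below-n (mex S))) ⟩
  not ((n <ᵇ n) ∨ elemℕ (mex S) S)
    ≡⟨ cong₂ (λ a b → not (a ∨ b)) (≥⇒<ᵇ-false (≤-refl {n})) (mex-∉ S) ⟩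
  true
    ∎)

nim : ℕ → Game
nim = star (λ _ → true)

isP-outcome-active : ∀ Os → isP (outcome (mk Os true)) ≡ not (anyP Os)
isP-outcome-active Os with anyP Os
... | true  = refl
... | false = refl

anyP-++ : ∀ xs ys → anyP (xs ++ ys) ≡ (anyP xs ∨ anyP ys)
anyP-++ []       ys = refl
anyP-++ (x ∷ xs) ys =
  trans (cong (isP (outcome x) ∨_) (anyP-++ xs ys)) (sym (∨-assoc (isP (outcome x)) _ _))

rightOpts-++ : ∀ Gs g xs ys →
  rightOpts Gs g (xs ++ ys) ≡ rightOpts Gs g xs ++ rightOpts Gs g ys
rightOpts-++ Gs g []       ys = refl
rightOpts-++ Gs g (x ∷ xs) ys = cong (_ ∷_) (rightOpts-++ Gs g xs ys)

mutual
  isP-⊕-nim : ∀ G m → isP (outcome (G ⊕ nim m)) ≡ (grundy G ≡ᵇ m)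
  isP-⊕-nim (mk Gs g) m = begin
    isP (outcome (mk Gs g ⊕ nim m))
      ≡⟨ cong (λ a → isP (outcome (mk options a))) (∨-zeroʳ g) ⟩
    isP (outcome (mk options true))
      ≡⟨ isP-outcome-active options ⟩
    not (anyP options)
      ≡⟨ cong not (anyP-++ (leftOpts Gs (nim m)) _) ⟩
    not (anyP (leftOpts Gs (nim m)) ∨ anyP (rightOpts Gs g (starsBelow _ m)))
      ≡⟨ cong₂ (λ a b → not (a ∨ b)) (anyP-leftOpts-nim m Gs) (anyP-rightOpts-nims Gs g m) ⟩
    not (elemℕ m (grundyList Gs) ∨ (grundy (mk Gs g) <ᵇ m))
      ≡⟨ mex-≡ᵇ (grundyList Gs) m ⟨
    grundy (mk Gs g) ≡ᵇ m
      ∎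
    where options = leftOpts Gs (nim m) ++ rightOpts Gs g (starsBelow _ m)

  anyP-leftOpts-nim : ∀ m Gs → anyP (leftOpts Gs (nim m)) ≡ elemℕ m (grundyList Gs)
  anyP-leftOpts-nim m []       = refl
  anyP-leftOpts-nim m (G ∷ Gs) =
    cong₂ _∨_ (trans (isP-⊕-nim G m) (≡ᵇ-sym (grundy G) m)) (anyP-leftOpts-nim m Gs)

  anyP-rightOpts-nims : ∀ Gs g m →
    anyP (rightOpts Gs g (starsBelow _ m)) ≡ (grundy (mk Gs g) <ᵇ m)
  anyP-rightOpts-nims Gs g zero    = refl
  anyP-rightOpts-nims Gs g (suc m) = begin
    anyP (rightOpts Gs g (starsBelow _ m ++ nim m ∷ []))
      ≡⟨ cong anyP (rightOpts-++ Gs g (starsBelow _ m) (nim m ∷ [])) ⟩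
    anyP (rightOpts Gs g (starsBelow _ m) ++ mk Gs g ⊕ nim m ∷ [])
      ≡⟨ anyP-++ (rightOpts Gs g (starsBelow _ m)) _ ⟩
    anyP (rightOpts Gs g (starsBelow _ m)) ∨ (isP (outcome (mk Gs g ⊕ nim m)) ∨ false)
      ≡⟨ cong₂ _∨_ (anyP-rightOpts-nims Gs g m)
                   (trans (∨-identityʳ _) (isP-⊕-nim (mk Gs g) m)) ⟩
    (grundy (mk Gs g) <ᵇ m) ∨ (grundy (mk Gs g) ≡ᵇ m)
      ≡⟨ <ᵇ-suc (grundy (mk Gs g)) m ⟨
    grundy (mk Gs g) <ᵇ suc m
      ∎

≈⇒grundy-≡ : ∀ G H → G ≈ H → grundy G ≡ grundy H
≈⇒grundy-≡ G H G≈H = ≡ᵇ-true⇒≡ (begin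
  grundy G ≡ᵇ grundy H                  ≡⟨ isP-⊕-nim G (grundy H) ⟨
  isP (outcome (G ⊕ nim (grundy H)))    ≡⟨ cong isP (G≈H (nim (grundy H))) ⟩
  isP (outcome (H ⊕ nim (grundy H)))    ≡⟨ isP-⊕-nim H (grundy H) ⟩
  grundy H ≡ᵇ grundy H                  ≡⟨ ≡ᵇ-refl (grundy H) ⟩
  true                                  ∎)

grundyList-++ : ∀ xs ys → grundyList (xs ++ ys) ≡ grundyList xs ++ grundyList ys
grundyList-++ []       ys = refl
grundyList-++ (x ∷ xs) ys = cong (_ ∷_) (grundyList-++ xs ys)

mutual
  grundy-star : ∀ γ n → grundy (star γ n) ≡ n
  grundy-star γ n =
    mex-initialSegment (grundyList (starsBelow γ n)) (elemℕ-grundyList-starsBelow γ n)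

  elemℕ-grundyList-starsBelow : ∀ γ n k →
    elemℕ k (grundyList (starsBelow γ n)) ≡ (k <ᵇ n)
  elemℕ-grundyList-starsBelow γ zero    k = refl
  elemℕ-grundyList-starsBelow γ (suc n) k = begin
    elemℕ k (grundyList (starsBelow γ n ++ star γ n ∷ []))
      ≡⟨ cong (elemℕ k) (grundyList-++ (starsBelow γ n) (star γ n ∷ [])) ⟩
    elemℕ k (grundyList (starsBelow γ n) ++ grundy (star γ n) ∷ [])
      ≡⟨ elemℕ-++ k (grundyList (starsBelow γ n)) _ ⟩
    elemℕ k (grundyList (starsBelow γ n)) ∨ ((k ≡ᵇ grundy (star γ n)) ∨ false)
      ≡⟨ cong₂ _∨_ (elemℕ-grundyList-starsBelow γ n k)
                   (trans (∨-identityʳ _) (cong (k ≡ᵇ_) (grundy-star γ n))) ⟩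
    (k <ᵇ n) ∨ (k ≡ᵇ n)
      ≡⟨ <ᵇ-suc k n ⟨
    k <ᵇ suc n
      ∎

theorem3p49 : (G : Game) (γ : ℕ → Bool) (n : ℕ) →
    G ≈ star γ n → grundy G ≡ n
theorem3p49 G γ n G≈∗ⁿ = trans (≈⇒grundy-≡ G (star γ n) G≈∗ⁿ) (grundy-star γ n)
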